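{- Let $G=(V,E)$ be a finite simple graph. Then \[ D(G,x)=(1+x)^{|V|}+\sum_{i=0}^{|V|-1}(1+x)^{i}\,\frac{(|V|-(i+1))!}{|V|!}\,A^{(i)}(G,x). \]
   Context: The domination polynomial of $G=(V,E)$ is $D(G,x)=\sum_{W\subseteq V,\ N_G[W]=V}x^{|W|}$, where $N_G[W]$ is the closed neighborhood of $W$; the graph with no vertices has $D=1$. Define \[ A(G,x)=\sum_{v\in V}\big(D(G-v,x)-D(G/v,x)-D(G-N[v],x)\big), \] where: - $G-v$ deletes $v$. - $G/v$ deletes $v$ and adds edges between all pairs of non-adjacent neighbors of $v$. - $G-N[v]$ deletes the closed neighborhood of $v$. $A^{(i)}$ is the $i$-th derivative with respect to $x$. -}

module Defs where

open import Data.Bool using (Bool; true; false; _∧_; _∨_; not; if_then_else_; T)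
open import Data.Nat as ℕ using (ℕ; zero; suc; _∸_; _!)
open import Data.Nat.Properties using (_!≢0)
open import Data.Fin using (Fin; zero; suc; _≟_)
open import Data.Vec using (Vec; []; _∷_; lookup; tabulate)
open import Data.List using (List; []; _∷_; map; filter; _++_; foldr; allFin)
open import Data.Fin.Subset using (Subset; ∣_∣)
open import Data.Integer using (+_)
open import Data.Rational using (ℚ; 0ℚ; 1ℚ; _+_; _*_; _-_; _/_)
open import Relation.Binary.PropositionalEquality using (_≡_)
open import Relation.Nullary.Decidable using (⌊_⌋)
open import Data.Bool.Properties using (T?)
open import Data.Fin.Subset using (⊤; ⁅_⁆; _─_)

record SimpleGraph (n : ℕ) : Set where
  field
    adj    : Fin n → Fin n → Bool
    sym    : ∀ u v → adj u v ≡ adj v u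
    irrefl : ∀ v → adj v v ≡ false
open SimpleGraph public

Adj : ℕ → Set
Adj n = Fin n → Fin n → Bool

-- Polynomials with rational coefficients, as coefficient sequences
-- (coefficient of x^k at index k).  Equality is pointwise.

Poly : Set
Poly = ℕ → ℚ

_≈ₚ_ : Poly → Poly → Set
p ≈ₚ q = ∀ k → p k ≡ q k

0ₚ : Poly
0ₚ _ = 0ℚ

_⊕_ : Poly → Poly → Poly
(p ⊕ q) k = p k + q k

_⊖_ : Poly → Poly → Poly
(p ⊖ q) k = p k - q k

_·_ : ℚ → Poly → Poly
(c · p) k = c * p k

X^ : ℕ → Poly
X^ m k = if ⌊ m ℕ.≟ k ⌋ then 1ℚ else 0ℚ

sumTo : ℕ → (ℕ → ℚ) → ℚ
sumTo zero    a = a 0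
sumTo (suc k) a = sumTo k a + a (suc k)

_⊗_ : Poly → Poly → Poly
(p ⊗ q) k = sumTo k (λ j → p j * q (k ∸ j))

1+x : Poly
1+x zero          = 1ℚ
1+x (suc zero)    = 1ℚ
1+x (suc (suc _)) = 0ℚ

_^ₚ_ : Poly → ℕ → Poly
p ^ₚ zero  = X^ 0
p ^ₚ suc m = p ⊗ (p ^ₚ m)

deriv : Poly → Poly
deriv p k = (+ suc k / 1) * p (suc k)

deriv^ : ℕ → Poly → Poly
deriv^ zero    p = p
deriv^ (suc i) p = deriv (deriv^ i p)

Σₚ : ℕ → (ℕ → Poly) → Poly
Σₚ zero    f = 0ₚ
Σₚ (suc m) f = Σₚ m f ⊕ f m

ΣL : {A : Set} → List A → (A → Poly) → Poly
ΣL xs f = foldr (λ a acc → f a ⊕ acc) 0ₚ xs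

allSubsets : (n : ℕ) → List (Subset n)
allSubsets zero    = [] ∷ []
allSubsets (suc n) = map (false ∷_) (allSubsets n) ++ map (true ∷_) (allSubsets n)

allB : {n : ℕ} → (Fin n → Bool) → Bool
allB {n} f = foldr (λ v b → f v ∧ b) true (allFin n)

anyB : {n : ℕ} → (Fin n → Bool) → Bool
anyB {n} f = foldr (λ v b → f v ∨ b) false (allFin n)

_∈ᵇ_ : {n : ℕ} → Fin n → Subset n → Bool
v ∈ᵇ S = lookup S v

_⊆ᵇ_ : {n : ℕ} → Subset n → Subset n → Bool
W ⊆ᵇ S = allB (λ v → not (v ∈ᵇ W) ∨ (v ∈ᵇ S))

Dominates : {n : ℕ} → Adj n → Subset n → Subset n → Bool
Dominates a S W =
  allB (λ u → not (u ∈ᵇ S) ∨ ((u ∈ᵇ W) ∨ anyB (λ w → (w ∈ᵇ W) ∧ a u w)))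

Dom : {n : ℕ} → Adj n → Subset n → Poly
Dom {n} a S =
  ΣL (filter (λ W → T? (W ⊆ᵇ S ∧ Dominates a S W)) (allSubsets n))
     (λ W → X^ ∣ W ∣)

-- The graph operations, each realised as a graph on a vertex subset of
-- Fin n (isomorphic to the graph obtained by actually deleting vertices).

module _ {n : ℕ} (G : SimpleGraph n) where

  D : Poly
  D = Dom (adj G) ⊤

  V-v : Fin n → Subset n
  V-v v = ⊤ ─ ⁅ v ⁆

  contractAdj : Fin n → Adj n
  contractAdj v a b = adj G a b ∨ ((adj G a v ∧ adj G b v) ∧ not ⌊ a ≟ b ⌋)

  V-N[v] : Fin n → Subset n
  V-N[v] v = tabulate (λ u → not (⌊ u ≟ v ⌋ ∨ adj G u v))

  D[G-v] : Fin n → Poly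
  D[G-v] v = Dom (adj G) (V-v v)

  D[G/v] : Fin n → Poly
  D[G/v] v = Dom (contractAdj v) (V-v v)

  D[G-N[v]] : Fin n → Poly
  D[G-N[v]] v = Dom (adj G) (V-N[v] v)

  A : Poly
  A = ΣL (allFin n) (λ v → (D[G-v] v ⊖ D[G/v] v) ⊖ D[G-N[v]] v)

factCoef : ℕ → ℕ → ℚ
factCoef n i = _/_ (+ ((n ∸ suc i) !)) (n !) {{n !≢0}}

module Submission where

-- Write n = |V| and D = D(G,x).  The proof has two halves.
-- (1) Combinatorial: A(G,x) = n·D − (1+x)·D', i.e. A_k = (n−k)·D_k − (k+1)·D_{k+1}.
--     For v ∉ W a case split on whether W meets the neighbourhood of v gives
--       [W dom. G−v] − [W dom. G/v] − [W dom. G−N[v]] = [W dom. G] − [W ∪ {v} dom. G];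
--     summed over v and W, a dominating set of size k is counted once per vertex
--     outside it, and one of size k+1 once per element.
-- (2) Algebraic: if D is monic of degree n and A = n·D − (1+x)·D', then
--     A^(i) = (n−i)·D^(i) − (1+x)·D^(i+1), so (1+x)^i (n−i−1)!/n! A^(i) = T_i − T_{i+1}
--     with T_i = (n−i)!/n! (1+x)^i D^(i); the sum telescopes to T_0 − T_n = D − (1+x)^n.

open import Defs hiding (sym)
open import Data.Bool using (Bool; true; false; _∧_; _∨_; not; T)
open import Data.Bool.Properties using (T?; T-∧; T-∨)
open import Data.Nat as ℕ using (ℕ; zero; suc; _∸_; _!; _≤_; z≤n; s≤s; NonZero)
import Data.Nat.Properties as ℕP
open import Data.Integer as ℤ using (+_)
import Data.Integer.Properties as ℤP
open import Data.Rational as ℚ using (ℚ; 0ℚ; 1ℚ; _+_; _*_; _-_; _/_; toℚᵘ)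
import Data.Rational.Properties as ℚP
open import Data.Rational.Unnormalised as ℚᵘ using (mkℚᵘ; *≡*)
import Data.Rational.Unnormalised.Properties as ℚᵘP
open import Data.Rational.Solver using (module +-*-Solver)
open +-*-Solver
open import Data.Fin using (Fin; zero; suc; _≟_)
open import Data.Fin.Properties using (any?)
open import Data.Vec using ([]; _∷_; _[_]≔_)
import Data.Vec.Properties as VecP
open import Data.List as List using (List; []; _∷_; _++_; foldr; filter; allFin)
import Data.List.Properties as ListP
open import Data.Fin.Subset using (Subset; ∣_∣; ⊤; ⁅_⁆; _─_)
open import Data.Fin.Subset.Properties using (∣p∣≤n; p─⊥≡p)
open import Relation.Nullary using (yes; no; Dec; ¬_)
open import Relation.Nullary.Decidable using (⌊_⌋; _×-dec_)
open import Data.Empty using (⊥-elim)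
open import Function using (_∘_; _⇔_; mk⇔; Equivalence)
open Equivalence using (to; from)
open import Data.Product as Prod using (_×_; _,_; proj₁; proj₂; ∃-syntax)
open import Data.Sum as Sum using (_⊎_; inj₁; inj₂; [_,_]′)
open import Data.Unit using (tt)
open import Relation.Binary.PropositionalEquality

ι : ℕ → ℚ
ι m = + m / 1

-- Computing with fractions goes through unnormalised rationals, where
-- + m / d is literally the fraction m/d.
toℚᵘ-/ : ∀ m d .{{_ : NonZero d}} → toℚᵘ (+ m / d) ℚᵘ.≃ mkℚᵘ (+ m) (ℕ.pred d)
toℚᵘ-/ m (suc d) = ℚP.toℚᵘ-fromℚᵘ (mkℚᵘ (+ m) d)

ι-+ : ∀ a b → ι (a ℕ.+ b) ≡ ι a + ι b
ι-+ a b = ℚP.toℚᵘ-injective (begin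
  toℚᵘ (ι (a ℕ.+ b))              ≈⟨ toℚᵘ-/ (a ℕ.+ b) 1 ⟩
  mkℚᵘ (+ (a ℕ.+ b)) 0            ≈⟨ *≡* integral-sum ⟩
  mkℚᵘ (+ a) 0 ℚᵘ.+ mkℚᵘ (+ b) 0  ≈⟨ ℚᵘP.≃-sym (ℚᵘP.+-cong (toℚᵘ-/ a 1) (toℚᵘ-/ b 1)) ⟩
  toℚᵘ (ι a) ℚᵘ.+ toℚᵘ (ι b)      ≈⟨ ℚᵘP.≃-sym (ℚP.toℚᵘ-homo-+ (ι a) (ι b)) ⟩
  toℚᵘ (ι a + ι b)                ∎)
  where
  open ℚᵘP.≃-Reasoning
  integral-sum : + (a ℕ.+ b) ℤ.* + 1 ≡ (+ a ℤ.* + 1 ℤ.+ + b ℤ.* + 1) ℤ.* + 1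
  integral-sum = trans (ℤP.*-identityʳ _) (trans (ℤP.pos-+ a b)
    (sym (trans (ℤP.*-identityʳ _) (cong₂ ℤ._+_ (ℤP.*-identityʳ (+ a)) (ℤP.*-identityʳ (+ b))))))

ι-*-/ : ∀ m c d .{{_ : NonZero d}} → ι m * (+ c / d) ≡ + (m ℕ.* c) / d
ι-*-/ m c (suc d) = ℚP.toℚᵘ-injective (begin
  toℚᵘ (ι m * (+ c / suc d))              ≈⟨ ℚP.toℚᵘ-homo-* (ι m) (+ c / suc d) ⟩
  toℚᵘ (ι m) ℚᵘ.* toℚᵘ (+ c / suc d)      ≈⟨ ℚᵘP.*-cong (toℚᵘ-/ m 1) (toℚᵘ-/ c (suc d)) ⟩
  mkℚᵘ (+ m) 0 ℚᵘ.* mkℚᵘ (+ c) d          ≈⟨ *≡* (cong₂ ℤ._*_ (sym (ℤP.pos-* m c)) (cong (λ z → + suc z) (sym (ℕP.+-identityʳ d)))) ⟩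
  mkℚᵘ (+ (m ℕ.* c)) d                    ≈⟨ ℚᵘP.≃-sym (toℚᵘ-/ (m ℕ.* c) (suc d)) ⟩
  toℚᵘ (+ (m ℕ.* c) / suc d)              ∎)
  where open ℚᵘP.≃-Reasoning

d/d≡1 : ∀ d .{{_ : NonZero d}} → + d / d ≡ 1ℚ
d/d≡1 (suc d) = ℚP.toℚᵘ-injective (ℚᵘP.≃-trans (toℚᵘ-/ (suc d) (suc d))
  (*≡* (cong (λ z → + suc z) (trans (ℕP.*-identityʳ d) (sym (ℕP.+-identityʳ d))))))

open ≡-Reasoning

private variable
  X Y : Set

sumL : List X → (X → ℚ) → ℚ
sumL xs h = foldr (λ x acc → h x + acc) 0ℚ xs

sumL-cong : ∀ (xs : List X) {f g : X → ℚ} → (∀ x → f x ≡ g x) → sumL xs f ≡ sumL xs g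
sumL-cong []       eq = refl
sumL-cong (x ∷ xs) eq = cong₂ _+_ (eq x) (sumL-cong xs eq)

sumL-zero : ∀ (xs : List X) {f : X → ℚ} → (∀ x → f x ≡ 0ℚ) → sumL xs f ≡ 0ℚ
sumL-zero []       eq = refl
sumL-zero (x ∷ xs) eq = cong₂ _+_ (eq x) (sumL-zero xs eq)

sumL-+ : ∀ (xs : List X) (f g : X → ℚ) → sumL xs (λ x → f x + g x) ≡ sumL xs f + sumL xs g
sumL-+ []       f g = sym (ℚP.+-identityˡ 0ℚ)
sumL-+ (x ∷ xs) f g = trans (cong (_+_ (f x + g x)) (sumL-+ xs f g))
  (solve 4 (λ a b c d → (a :+ b) :+ (c :+ d) := (a :+ c) :+ (b :+ d)) refl (f x) (g x) (sumL xs f) (sumL xs g))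

sumL-- : ∀ (xs : List X) (f g : X → ℚ) → sumL xs (λ x → f x - g x) ≡ sumL xs f - sumL xs g
sumL-- []       f g = refl
sumL-- (x ∷ xs) f g = trans (cong (_+_ (f x - g x)) (sumL-- xs f g))
  (solve 4 (λ a b c d → (a :- b) :+ (c :- d) := (a :+ c) :- (b :+ d)) refl (f x) (g x) (sumL xs f) (sumL xs g))

sumL-* : ∀ (xs : List X) c (f : X → ℚ) → sumL xs (λ x → c * f x) ≡ c * sumL xs f
sumL-* []       c f = sym (ℚP.*-zeroʳ c)
sumL-* (x ∷ xs) c f = trans (cong (_+_ (c * f x)) (sumL-* xs c f)) (sym (ℚP.*-distribˡ-+ c (f x) (sumL xs f)))

sumL-*ʳ : ∀ (xs : List X) c (f : X → ℚ) → sumL xs (λ x → f x * c) ≡ sumL xs f * c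
sumL-*ʳ xs c f = trans (sumL-cong xs (λ x → ℚP.*-comm (f x) c)) (trans (sumL-* xs c f) (ℚP.*-comm c (sumL xs f)))

sumL-++ : ∀ (xs ys : List X) (f : X → ℚ) → sumL (xs ++ ys) f ≡ sumL xs f + sumL ys f
sumL-++ []       ys f = sym (ℚP.+-identityˡ _)
sumL-++ (x ∷ xs) ys f = trans (cong (_+_ (f x)) (sumL-++ xs ys f)) (sym (ℚP.+-assoc (f x) _ _))

sumL-map : ∀ (g : Y → X) (ys : List Y) (f : X → ℚ) → sumL (List.map g ys) f ≡ sumL ys (λ y → f (g y))
sumL-map g []       f = refl
sumL-map g (y ∷ ys) f = cong (_+_ (f (g y))) (sumL-map g ys f)

sumL-swap : ∀ (xs : List X) (ys : List Y) (f : X → Y → ℚ) →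
  sumL xs (λ x → sumL ys (f x)) ≡ sumL ys (λ y → sumL xs (λ x → f x y))
sumL-swap []       ys f = sym (sumL-zero ys (λ _ → refl))
sumL-swap (x ∷ xs) ys f = trans (cong (_+_ (sumL ys (f x))) (sumL-swap xs ys f))
  (sym (sumL-+ ys (f x) (λ y → sumL xs (λ x′ → f x′ y))))

sumV : (n : ℕ) → (Fin n → ℚ) → ℚ
sumV n = sumL (allFin n)

sumV-suc : ∀ n (f : Fin (suc n) → ℚ) → sumV (suc n) f ≡ f zero + sumV n (λ v → f (suc v))
sumV-suc n f = cong (_+_ (f zero)) (begin
  sumL (List.tabulate suc) f                  ≡⟨ cong (λ vs → sumL vs f) (sym (ListP.map-tabulate (λ v → v) suc)) ⟩
  sumL (List.map suc (allFin n)) f            ≡⟨ sumL-map suc (allFin n) f ⟩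
  sumV n (λ v → f (suc v))                    ∎)

sumS : (n : ℕ) → (Subset n → ℚ) → ℚ
sumS n = sumL (allSubsets n)

sumS-suc : ∀ n (f : Subset (suc n) → ℚ) → sumS (suc n) f ≡ sumS n (λ W → f (false ∷ W)) + sumS n (λ W → f (true ∷ W))
sumS-suc n f = begin
  sumL (List.map (false ∷_) (allSubsets n) ++ List.map (true ∷_) (allSubsets n)) f
    ≡⟨ sumL-++ (List.map (false ∷_) (allSubsets n)) _ f ⟩
  sumL (List.map (false ∷_) (allSubsets n)) f + sumL (List.map (true ∷_) (allSubsets n)) f
    ≡⟨ cong₂ _+_ (sumL-map (false ∷_) (allSubsets n) f) (sumL-map (true ∷_) (allSubsets n) f) ⟩
  sumS n (λ W → f (false ∷ W)) + sumS n (λ W → f (true ∷ W)) ∎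


sumTo-cong : ∀ k {a b : ℕ → ℚ} → (∀ j → j ≤ k → a j ≡ b j) → sumTo k a ≡ sumTo k b
sumTo-cong zero    eq = eq 0 z≤n
sumTo-cong (suc k) eq = cong₂ _+_ (sumTo-cong k (λ j j≤k → eq j (ℕP.m≤n⇒m≤1+n j≤k))) (eq (suc k) ℕP.≤-refl)

sumTo-zero : ∀ k {a : ℕ → ℚ} → (∀ j → a j ≡ 0ℚ) → sumTo k a ≡ 0ℚ
sumTo-zero zero    eq = eq 0
sumTo-zero (suc k) eq = cong₂ _+_ (sumTo-zero k eq) (eq (suc k))

sumTo-suc : ∀ k (a : ℕ → ℚ) → sumTo (suc k) a ≡ a 0 + sumTo k (λ j → a (suc j))
sumTo-suc zero    a = refl
sumTo-suc (suc k) a = trans (cong (_+ a (suc (suc k))) (sumTo-suc k a)) (ℚP.+-assoc (a 0) _ _)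

sumTo-+ : ∀ k (a b : ℕ → ℚ) → sumTo k (λ j → a j + b j) ≡ sumTo k a + sumTo k b
sumTo-+ zero    a b = refl
sumTo-+ (suc k) a b = trans (cong (_+ (a (suc k) + b (suc k))) (sumTo-+ k a b))
  (solve 4 (λ w x y z → (w :+ x) :+ (y :+ z) := (w :+ y) :+ (x :+ z)) refl (sumTo k a) (sumTo k b) (a (suc k)) (b (suc k)))

sumTo-- : ∀ k (a b : ℕ → ℚ) → sumTo k (λ j → a j - b j) ≡ sumTo k a - sumTo k b
sumTo-- zero    a b = refl
sumTo-- (suc k) a b = trans (cong (_+ (a (suc k) - b (suc k))) (sumTo-- k a b))
  (solve 4 (λ w x y z → (w :- x) :+ (y :- z) := (w :+ y) :- (x :+ z)) refl (sumTo k a) (sumTo k b) (a (suc k)) (b (suc k)))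

sumTo-* : ∀ k c (a : ℕ → ℚ) → sumTo k (λ j → c * a j) ≡ c * sumTo k a
sumTo-* zero    c a = refl
sumTo-* (suc k) c a = trans (cong (_+ c * a (suc k)) (sumTo-* k c a)) (sym (ℚP.*-distribˡ-+ c (sumTo k a) (a (suc k))))

mul1+x : Poly → Poly
mul1+x p zero    = p zero
mul1+x p (suc k) = p (suc k) + p k

1+x⊗-≈ : ∀ p → (1+x ⊗ p) ≈ₚ mul1+x p
1+x⊗-≈ p zero    = ℚP.*-identityˡ (p 0)
1+x⊗-≈ p (suc k) = begin
  sumTo (suc k) (λ j → 1+x j * p (suc k ∸ j))
    ≡⟨ sumTo-suc k (λ j → 1+x j * p (suc k ∸ j)) ⟩
  1ℚ * p (suc k) + sumTo k (λ j → 1+x (suc j) * p (k ∸ j))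
    ≡⟨ cong₂ _+_ (ℚP.*-identityˡ (p (suc k))) (only-linear-term k) ⟩
  p (suc k) + p k ∎
  where
  -- among the coefficients of 1+x at positions ≥ 1 only the first is non-zero
  only-linear-term : ∀ k → sumTo k (λ j → 1+x (suc j) * p (k ∸ j)) ≡ p k
  only-linear-term zero    = ℚP.*-identityˡ (p 0)
  only-linear-term (suc k) = begin
    sumTo (suc k) (λ j → 1+x (suc j) * p (suc k ∸ j))
      ≡⟨ sumTo-suc k (λ j → 1+x (suc j) * p (suc k ∸ j)) ⟩
    1ℚ * p (suc k) + sumTo k (λ j → 0ℚ * p (k ∸ j))
      ≡⟨ cong₂ _+_ (ℚP.*-identityˡ (p (suc k))) (sumTo-zero k (λ j → ℚP.*-zeroˡ (p (k ∸ j)))) ⟩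
    p (suc k) + 0ℚ
      ≡⟨ ℚP.+-identityʳ _ ⟩
    p (suc k) ∎

⊗-congˡ : ∀ {p q} r → p ≈ₚ q → (p ⊗ r) ≈ₚ (q ⊗ r)
⊗-congˡ r eq k = sumTo-cong k (λ j _ → cong (_* r (k ∸ j)) (eq j))

⊗-congʳ : ∀ p {q r} → q ≈ₚ r → (p ⊗ q) ≈ₚ (p ⊗ r)
⊗-congʳ p eq k = sumTo-cong k (λ j _ → cong (p j *_) (eq (k ∸ j)))

mul1+x-⊗ˡ : ∀ p q → (mul1+x p ⊗ q) ≈ₚ mul1+x (p ⊗ q)
mul1+x-⊗ˡ p q zero    = refl
mul1+x-⊗ˡ p q (suc k) = begin
  sumTo (suc k) (λ j → mul1+x p j * q (suc k ∸ j))
    ≡⟨ sumTo-suc k (λ j → mul1+x p j * q (suc k ∸ j)) ⟩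
  p 0 * q (suc k) + sumTo k (λ j → (p (suc j) + p j) * q (k ∸ j))
    ≡⟨ cong (_+_ (p 0 * q (suc k))) (trans (sumTo-cong k (λ j _ → ℚP.*-distribʳ-+ (q (k ∸ j)) (p (suc j)) (p j)))
                                            (sumTo-+ k (λ j → p (suc j) * q (k ∸ j)) (λ j → p j * q (k ∸ j)))) ⟩
  p 0 * q (suc k) + (sumTo k (λ j → p (suc j) * q (k ∸ j)) + (p ⊗ q) k)
    ≡⟨ sym (ℚP.+-assoc (p 0 * q (suc k)) _ _) ⟩
  (p 0 * q (suc k) + sumTo k (λ j → p (suc j) * q (k ∸ j))) + (p ⊗ q) k
    ≡⟨ cong (_+ (p ⊗ q) k) (sym (sumTo-suc k (λ j → p j * q (suc k ∸ j)))) ⟩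
  (p ⊗ q) (suc k) + (p ⊗ q) k ∎

mul1+x-⊗ʳ : ∀ p q → (p ⊗ mul1+x q) ≈ₚ mul1+x (p ⊗ q)
mul1+x-⊗ʳ p q zero    = refl
mul1+x-⊗ʳ p q (suc k) = begin
  sumTo k (λ j → p j * mul1+x q (suc k ∸ j)) + p (suc k) * mul1+x q (k ∸ k)
    ≡⟨ cong₂ _+_ (sumTo-cong k split) (cong (λ z → p (suc k) * mul1+x q z) (ℕP.n∸n≡0 k)) ⟩
  sumTo k (λ j → p j * q (suc k ∸ j) + p j * q (k ∸ j)) + p (suc k) * q 0
    ≡⟨ cong (_+ p (suc k) * q 0) (sumTo-+ k _ _) ⟩
  (sumTo k (λ j → p j * q (suc k ∸ j)) + (p ⊗ q) k) + p (suc k) * q 0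
    ≡⟨ solve 3 (λ x y z → (x :+ y) :+ z := (x :+ z) :+ y) refl (sumTo k (λ j → p j * q (suc k ∸ j))) ((p ⊗ q) k) (p (suc k) * q 0) ⟩
  (sumTo k (λ j → p j * q (suc k ∸ j)) + p (suc k) * q 0) + (p ⊗ q) k
    ≡⟨ cong (λ z → (sumTo k (λ j → p j * q (suc k ∸ j)) + p (suc k) * q z) + (p ⊗ q) k) (sym (ℕP.n∸n≡0 k)) ⟩
  (p ⊗ q) (suc k) + (p ⊗ q) k ∎
  where
  split : ∀ j → j ≤ k → p j * mul1+x q (suc k ∸ j) ≡ p j * q (suc k ∸ j) + p j * q (k ∸ j)
  split j j≤k rewrite ℕP.+-∸-assoc 1 j≤k = ℚP.*-distribˡ-+ (p j) _ _

⊗-identityˡ : ∀ q → (X^ 0 ⊗ q) ≈ₚ q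
⊗-identityˡ q zero    = ℚP.*-identityˡ (q 0)
⊗-identityˡ q (suc k) = begin
  sumTo (suc k) (λ j → X^ 0 j * q (suc k ∸ j))
    ≡⟨ sumTo-suc k (λ j → X^ 0 j * q (suc k ∸ j)) ⟩
  1ℚ * q (suc k) + sumTo k (λ j → 0ℚ * q (k ∸ j))
    ≡⟨ cong₂ _+_ (ℚP.*-identityˡ (q (suc k))) (sumTo-zero k (λ j → ℚP.*-zeroˡ (q (k ∸ j)))) ⟩
  q (suc k) + 0ℚ
    ≡⟨ ℚP.+-identityʳ _ ⟩
  q (suc k) ∎

⊗-identityʳ : ∀ p → (p ⊗ X^ 0) ≈ₚ p
⊗-identityʳ p zero    = ℚP.*-identityʳ (p 0)
⊗-identityʳ p (suc k) = begin
  sumTo k (λ j → p j * X^ 0 (suc k ∸ j)) + p (suc k) * X^ 0 (k ∸ k)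
    ≡⟨ cong₂ _+_ (trans (sumTo-cong k off-diagonal) (sumTo-zero k (λ _ → refl))) (cong (λ z → p (suc k) * X^ 0 z) (ℕP.n∸n≡0 k)) ⟩
  0ℚ + p (suc k) * 1ℚ
    ≡⟨ trans (ℚP.+-identityˡ _) (ℚP.*-identityʳ _) ⟩
  p (suc k) ∎
  where
  off-diagonal : ∀ j → j ≤ k → p j * X^ 0 (suc k ∸ j) ≡ 0ℚ
  off-diagonal j j≤k rewrite ℕP.+-∸-assoc 1 j≤k = ℚP.*-zeroʳ (p j)

1+x^-mul1+x : ∀ i q → ((1+x ^ₚ i) ⊗ mul1+x q) ≈ₚ ((1+x ^ₚ suc i) ⊗ q)
1+x^-mul1+x i q k = sym (begin
  ((1+x ⊗ (1+x ^ₚ i)) ⊗ q) k      ≡⟨ ⊗-congˡ q (1+x⊗-≈ (1+x ^ₚ i)) k ⟩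
  (mul1+x (1+x ^ₚ i) ⊗ q) k       ≡⟨ mul1+x-⊗ˡ (1+x ^ₚ i) q k ⟩
  mul1+x ((1+x ^ₚ i) ⊗ q) k       ≡⟨ sym (mul1+x-⊗ʳ (1+x ^ₚ i) q k) ⟩
  ((1+x ^ₚ i) ⊗ mul1+x q) k       ∎)

deriv-mul1+x : ∀ p → deriv (mul1+x p) ≈ₚ (p ⊕ mul1+x (deriv p))
deriv-mul1+x p zero = solve 2 (λ x y → con 1ℚ :* (x :+ y) := y :+ con 1ℚ :* x) refl (p 1) (p 0)
deriv-mul1+x p (suc k) = begin
  ι (suc (suc k)) * (p (suc (suc k)) + p (suc k))
    ≡⟨ cong (_* (p (suc (suc k)) + p (suc k))) (ι-+ 1 (suc k)) ⟩
  (1ℚ + ι (suc k)) * (p (suc (suc k)) + p (suc k))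
    ≡⟨ solve 3 (λ a x y → (con 1ℚ :+ a) :* (x :+ y) := y :+ ((con 1ℚ :+ a) :* x :+ a :* y)) refl (ι (suc k)) (p (suc (suc k))) (p (suc k)) ⟩
  p (suc k) + ((1ℚ + ι (suc k)) * p (suc (suc k)) + ι (suc k) * p (suc k))
    ≡⟨ cong (λ z → p (suc k) + (z * p (suc (suc k)) + ι (suc k) * p (suc k))) (sym (ι-+ 1 (suc k))) ⟩
  p (suc k) + (ι (suc (suc k)) * p (suc (suc k)) + ι (suc k) * p (suc k)) ∎

nD-mul1+xD′-coeff : ∀ n D k → ((ι n · D) ⊖ mul1+x (deriv D)) k ≡ (ι n - ι k) * D k - ι (suc k) * D (suc k)
nD-mul1+xD′-coeff n D zero    = solve 3 (λ a x y → a :* x :- y := (a :- con 0ℚ) :* x :- y) refl (ι n) (D 0) (ι 1 * D 1)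
nD-mul1+xD′-coeff n D (suc k) = solve 5 (λ a b c x y → a :* x :- (c :* y :+ b :* x) := (a :- b) :* x :- c :* y) refl
                                  (ι n) (ι (suc k)) (ι (suc (suc k))) (D (suc k)) (D (suc (suc k)))

-- rising k i = (k+1)(k+2)···(k+i), the factor produced by i derivatives
-- at the coefficient of x^k.
rising : ℕ → ℕ → ℕ
rising k zero    = 1
rising k (suc i) = suc k ℕ.* rising (suc k) i

rising-! : ∀ k i → (k !) ℕ.* rising k i ≡ (i ℕ.+ k) !
rising-! k zero    = ℕP.*-identityʳ (k !)
rising-! k (suc i) = begin
  (k !) ℕ.* (suc k ℕ.* rising (suc k) i)   ≡⟨ sym (ℕP.*-assoc (k !) (suc k) _) ⟩
  ((k !) ℕ.* suc k) ℕ.* rising (suc k) i   ≡⟨ cong (ℕ._* rising (suc k) i) (ℕP.*-comm (k !) (suc k)) ⟩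
  (suc k !) ℕ.* rising (suc k) i           ≡⟨ rising-! (suc k) i ⟩
  (i ℕ.+ suc k) !                          ≡⟨ cong _! (ℕP.+-suc i k) ⟩
  (suc i ℕ.+ k) !                          ∎

deriv^-coeff : ∀ i p k → deriv^ i p k ≡ ι (rising k i) * p (i ℕ.+ k)
deriv^-coeff zero    p k = sym (ℚP.*-identityˡ (p k))
deriv^-coeff (suc i) p k = begin
  ι (suc k) * deriv^ i p (suc k)                             ≡⟨ cong (ι (suc k) *_) (deriv^-coeff i p (suc k)) ⟩
  ι (suc k) * (ι (rising (suc k) i) * p (i ℕ.+ suc k))       ≡⟨ sym (ℚP.*-assoc (ι (suc k)) _ _) ⟩
  (ι (suc k) * ι (rising (suc k) i)) * p (i ℕ.+ suc k)       ≡⟨ cong₂ _*_ (ι-*-/ (suc k) (rising (suc k) i) 1) (cong p (ℕP.+-suc i k)) ⟩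
  ι (rising k (suc i)) * p (suc i ℕ.+ k)                     ∎

deriv^-monic : ∀ n (p : Poly) → p n ≡ 1ℚ → (∀ k → p (n ℕ.+ suc k) ≡ 0ℚ) → deriv^ n p ≈ₚ (ι (n !) · X^ 0)
deriv^-monic n p leading above zero = begin
  deriv^ n p 0                 ≡⟨ deriv^-coeff n p 0 ⟩
  ι (rising 0 n) * p (n ℕ.+ 0) ≡⟨ cong₂ _*_ (cong ι rising-0) (trans (cong p (ℕP.+-identityʳ n)) leading) ⟩
  ι (n !) * 1ℚ                 ∎
  where
  rising-0 : rising 0 n ≡ n !
  rising-0 = trans (sym (ℕP.+-identityʳ (rising 0 n))) (trans (rising-! 0 n) (cong _! (ℕP.+-identityʳ n)))
deriv^-monic n p leading above (suc k) = begin
  deriv^ n p (suc k)                           ≡⟨ deriv^-coeff n p (suc k) ⟩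
  ι (rising (suc k) n) * p (n ℕ.+ suc k)       ≡⟨ cong (ι (rising (suc k) n) *_) (above k) ⟩
  ι (rising (suc k) n) * 0ℚ                    ≡⟨ ℚP.*-zeroʳ (ι (rising (suc k) n)) ⟩
  0ℚ                                           ≡⟨ sym (ℚP.*-zeroʳ (ι (n !))) ⟩
  ι (n !) * 0ℚ                                 ∎

module Expansion (n : ℕ) (D A : Poly)
                 (A-eq : A ≈ₚ ((ι n · D) ⊖ mul1+x (deriv D)))
                 (leading : D n ≡ 1ℚ) (above : ∀ k → D (n ℕ.+ suc k) ≡ 0ℚ) where

  deriv^-A : ∀ i → deriv^ i A ≈ₚ (((ι n - ι i) · deriv^ i D) ⊖ mul1+x (deriv^ (suc i) D))
  deriv^-A zero    k = trans (A-eq k) (cong (λ c → c * D k - mul1+x (deriv D) k) (sym (ℚP.+-identityʳ (ι n))))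
  deriv^-A (suc i) k = begin
    ι (suc k) * deriv^ i A (suc k)
      ≡⟨ cong (ι (suc k) *_) (deriv^-A i (suc k)) ⟩
    ι (suc k) * ((ι n - ι i) * Dⁱ (suc k) - mul1+x Dⁱ⁺¹ (suc k))
      ≡⟨ solve 4 (λ a b x y → a :* (b :* x :- y) := b :* (a :* x) :- a :* y) refl (ι (suc k)) (ι n - ι i) (Dⁱ (suc k)) (mul1+x Dⁱ⁺¹ (suc k)) ⟩
    (ι n - ι i) * Dⁱ⁺¹ k - deriv (mul1+x Dⁱ⁺¹) k
      ≡⟨ cong (λ z → (ι n - ι i) * Dⁱ⁺¹ k - z) (deriv-mul1+x Dⁱ⁺¹ k) ⟩
    (ι n - ι i) * Dⁱ⁺¹ k - (Dⁱ⁺¹ k + mul1+x (deriv Dⁱ⁺¹) k)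
      ≡⟨ solve 4 (λ a b x y → (a :- b) :* x :- (x :+ y) := (a :- (con 1ℚ :+ b)) :* x :- y) refl (ι n) (ι i) (Dⁱ⁺¹ k) (mul1+x (deriv Dⁱ⁺¹) k) ⟩
    (ι n - (1ℚ + ι i)) * Dⁱ⁺¹ k - mul1+x (deriv Dⁱ⁺¹) k
      ≡⟨ cong (λ z → (ι n - z) * Dⁱ⁺¹ k - mul1+x (deriv Dⁱ⁺¹) k) (sym (ι-+ 1 i)) ⟩
    (ι n - ι (suc i)) * Dⁱ⁺¹ k - mul1+x (deriv Dⁱ⁺¹) k ∎
    where
    Dⁱ Dⁱ⁺¹ : Poly
    Dⁱ   = deriv^ i D
    Dⁱ⁺¹ = deriv^ (suc i) D

  weight : ℕ → ℚ
  weight i = _/_ (+ ((n ∸ i) !)) (n !) {{n ℕP.!≢0}}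

  factCoef-weight : ∀ i → suc i ≤ n → (ι n - ι i) * factCoef n i ≡ weight i
  factCoef-weight i i<n = begin
    (ι n - ι i) * factCoef n i
      ≡⟨ cong (_* factCoef n i) n-i≡n∸i ⟩
    ι (n ∸ i) * factCoef n i
      ≡⟨ ι-*-/ (n ∸ i) ((n ∸ suc i) !) (n !) {{n ℕP.!≢0}} ⟩
    _/_ (+ ((n ∸ i) ℕ.* ((n ∸ suc i) !))) (n !) {{n ℕP.!≢0}}
      ≡⟨ cong (λ m → _/_ (+ (m ℕ.* ((n ∸ suc i) !))) (n !) {{n ℕP.!≢0}}) n∸i≡1+n∸1+i ⟩
    _/_ (+ (suc (n ∸ suc i) !)) (n !) {{n ℕP.!≢0}}
      ≡⟨ cong (λ m → _/_ (+ (m !)) (n !) {{n ℕP.!≢0}}) (sym n∸i≡1+n∸1+i) ⟩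
    weight i ∎
    where
    n∸i≡1+n∸1+i : n ∸ i ≡ suc (n ∸ suc i)
    n∸i≡1+n∸1+i = ℕP.+-∸-assoc 1 i<n
    n-i≡n∸i : ι n - ι i ≡ ι (n ∸ i)
    n-i≡n∸i = begin
      ι n - ι i                  ≡⟨ cong (λ m → ι m - ι i) (sym (ℕP.m∸n+n≡m (ℕP.<⇒≤ i<n))) ⟩
      ι (n ∸ i ℕ.+ i) - ι i      ≡⟨ cong (_- ι i) (ι-+ (n ∸ i) i) ⟩
      (ι (n ∸ i) + ι i) - ι i    ≡⟨ solve 2 (λ a b → (a :+ b) :- b := a) refl (ι (n ∸ i)) (ι i) ⟩
      ι (n ∸ i)                  ∎

  weight-0 : weight 0 ≡ 1ℚ
  weight-0 = d/d≡1 (n !) {{n ℕP.!≢0}}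

  weight-n : weight n * ι (n !) ≡ 1ℚ
  weight-n = begin
    weight n * ι (n !)                                ≡⟨ ℚP.*-comm (weight n) _ ⟩
    ι (n !) * weight n                                ≡⟨ cong (λ m → ι (n !) * _/_ (+ (m !)) (n !) {{n ℕP.!≢0}}) (ℕP.n∸n≡0 n) ⟩
    ι (n !) * _/_ (+ 1) (n !) {{n ℕP.!≢0}}            ≡⟨ ι-*-/ (n !) 1 (n !) {{n ℕP.!≢0}} ⟩
    _/_ (+ ((n !) ℕ.* 1)) (n !) {{n ℕP.!≢0}}          ≡⟨ cong (λ m → _/_ (+ m) (n !) {{n ℕP.!≢0}}) (ℕP.*-identityʳ (n !)) ⟩
    _/_ (+ (n !)) (n !) {{n ℕP.!≢0}}                  ≡⟨ d/d≡1 (n !) {{n ℕP.!≢0}} ⟩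
    1ℚ                                                ∎

  Tele : ℕ → Poly
  Tele i = weight i · ((1+x ^ₚ i) ⊗ deriv^ i D)

  term : ℕ → Poly
  term i = (1+x ^ₚ i) ⊗ (factCoef n i · deriv^ i A)

  term≈Tele-Tele : ∀ i → suc i ≤ n → term i ≈ₚ (Tele i ⊖ Tele (suc i))
  term≈Tele-Tele i i<n k = begin
    sumTo k (λ j → P j * (c * deriv^ i A (k ∸ j)))
      ≡⟨ sumTo-cong k (λ j _ → cong (λ z → P j * (c * z)) (deriv^-A i (k ∸ j))) ⟩
    sumTo k (λ j → P j * (c * (α * Dⁱ (k ∸ j) - mul1+x Dⁱ⁺¹ (k ∸ j))))
      ≡⟨ sumTo-cong k (λ j _ → solve 5 (λ p c a x y → p :* (c :* (a :* x :- y)) := (c :* a) :* (p :* x) :- c :* (p :* y)) refl (P j) c α (Dⁱ (k ∸ j)) (mul1+x Dⁱ⁺¹ (k ∸ j))) ⟩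
    sumTo k (λ j → (c * α) * (P j * Dⁱ (k ∸ j)) - c * (P j * mul1+x Dⁱ⁺¹ (k ∸ j)))
      ≡⟨ sumTo-- k _ _ ⟩
    sumTo k (λ j → (c * α) * (P j * Dⁱ (k ∸ j))) - sumTo k (λ j → c * (P j * mul1+x Dⁱ⁺¹ (k ∸ j)))
      ≡⟨ cong₂ _-_ (sumTo-* k (c * α) _) (sumTo-* k c _) ⟩
    (c * α) * (P ⊗ Dⁱ) k - c * (P ⊗ mul1+x Dⁱ⁺¹) k
      ≡⟨ cong₂ (λ u v → u * (P ⊗ Dⁱ) k - c * v) (trans (ℚP.*-comm c α) (factCoef-weight i i<n)) (1+x^-mul1+x i Dⁱ⁺¹ k) ⟩
    Tele i k - Tele (suc i) k ∎
    where
    P Dⁱ Dⁱ⁺¹ : Poly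
    P    = 1+x ^ₚ i
    Dⁱ   = deriv^ i D
    Dⁱ⁺¹ = deriv^ (suc i) D
    c α : ℚ
    c = factCoef n i
    α = ι n - ι i

  telescope : ∀ m → m ≤ n → Σₚ m term ≈ₚ (Tele 0 ⊖ Tele m)
  telescope zero    _   k = sym (ℚP.+-inverseʳ (Tele 0 k))
  telescope (suc m) m<n k = begin
    Σₚ m term k + term m k
      ≡⟨ cong₂ _+_ (telescope m (ℕP.<⇒≤ m<n) k) (term≈Tele-Tele m m<n k) ⟩
    (Tele 0 k - Tele m k) + (Tele m k - Tele (suc m) k)
      ≡⟨ solve 3 (λ a b c → (a :- b) :+ (b :- c) := a :- c) refl (Tele 0 k) (Tele m k) (Tele (suc m) k) ⟩
    Tele 0 k - Tele (suc m) k ∎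

  Tele-0 : Tele 0 ≈ₚ D
  Tele-0 k = trans (cong₂ _*_ weight-0 (⊗-identityˡ D k)) (ℚP.*-identityˡ (D k))

  Tele-n : Tele n ≈ₚ (1+x ^ₚ n)
  Tele-n k = begin
    weight n * ((1+x ^ₚ n) ⊗ deriv^ n D) k
      ≡⟨ cong (weight n *_) (⊗-congʳ (1+x ^ₚ n) (deriv^-monic n D leading above) k) ⟩
    weight n * sumTo k (λ j → P j * (ι (n !) * X^ 0 (k ∸ j)))
      ≡⟨ cong (weight n *_) (trans (sumTo-cong k (λ j _ → solve 3 (λ a b c → a :* (b :* c) := b :* (a :* c)) refl (P j) (ι (n !)) (X^ 0 (k ∸ j))))
                                   (sumTo-* k (ι (n !)) (λ j → P j * X^ 0 (k ∸ j)))) ⟩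
    weight n * (ι (n !) * (P ⊗ X^ 0) k)
      ≡⟨ sym (ℚP.*-assoc (weight n) (ι (n !)) _) ⟩
    (weight n * ι (n !)) * (P ⊗ X^ 0) k
      ≡⟨ cong₂ _*_ weight-n (⊗-identityʳ P k) ⟩
    1ℚ * P k
      ≡⟨ ℚP.*-identityˡ (P k) ⟩
    P k ∎
    where
    P : Poly
    P = 1+x ^ₚ n

  expansion : D ≈ₚ ((1+x ^ₚ n) ⊕ Σₚ n term)
  expansion k = sym (begin
    (1+x ^ₚ n) k + Σₚ n term k             ≡⟨ cong (_+_ ((1+x ^ₚ n) k)) (telescope n ℕP.≤-refl k) ⟩
    (1+x ^ₚ n) k + (Tele 0 k - Tele n k)   ≡⟨ cong₂ (λ u v → (1+x ^ₚ n) k + (u - v)) (Tele-0 k) (Tele-n k) ⟩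
    (1+x ^ₚ n) k + (D k - (1+x ^ₚ n) k)    ≡⟨ solve 2 (λ a b → a :+ (b :- a) := b) refl ((1+x ^ₚ n) k) (D k) ⟩
    D k                                    ∎)

ind : Bool → ℚ
ind true  = 1ℚ
ind false = 0ℚ

ΣL-filter : ∀ (xs : List X) (b : X → Bool) (g : X → Poly) k →
  ΣL (filter (λ x → T? (b x)) xs) g k ≡ sumL xs (λ x → ind (b x) * g x k)
ΣL-filter []       b g k = refl
ΣL-filter (x ∷ xs) b g k with b x
... | true  = cong₂ _+_ (sym (ℚP.*-identityˡ (g x k))) (ΣL-filter xs b g k)
... | false = trans (ΣL-filter xs b g k) (sym (trans (cong (_+ _) (ℚP.*-zeroˡ (g x k))) (ℚP.+-identityˡ _)))

Dom-coeff : ∀ {n} (a : Adj n) (S : Subset n) k →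
  Dom a S k ≡ sumS n (λ W → ind (W ⊆ᵇ S ∧ Dominates a S W) * X^ ∣ W ∣ k)
Dom-coeff {n} a S = ΣL-filter (allSubsets n) (λ W → W ⊆ᵇ S ∧ Dominates a S W) (λ W → X^ ∣ W ∣)

X^-diag : ∀ m → X^ m m ≡ 1ℚ
X^-diag m with m ℕ.≟ m
... | yes _  = refl
... | no m≢m = ⊥-elim (m≢m refl)

X^-off : ∀ m k → m ≢ k → X^ m k ≡ 0ℚ
X^-off m k m≢k with m ℕ.≟ k
... | yes m≡k = ⊥-elim (m≢k m≡k)
... | no _    = refl

X^-suc : ∀ m k → X^ (suc m) (suc k) ≡ X^ m k
X^-suc m k = by-cases (m ℕ.≟ k)
  where
  by-cases : Dec (m ≡ k) → X^ (suc m) (suc k) ≡ X^ m k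
  by-cases (yes refl) = trans (X^-diag (suc m)) (sym (X^-diag m))
  by-cases (no m≢k)   = trans (X^-off (suc m) (suc k) (m≢k ∘ ℕP.suc-injective)) (sym (X^-off m k m≢k))

X^-select : ∀ m k (f : ℕ → ℚ) → X^ m k * f m ≡ X^ m k * f k
X^-select m k f = by-cases (m ℕ.≟ k)
  where
  by-cases : Dec (m ≡ k) → X^ m k * f m ≡ X^ m k * f k
  by-cases (yes refl) = refl
  by-cases (no m≢k)   = trans (cong (_* f m) (X^-off m k m≢k))
    (trans (ℚP.*-zeroˡ (f m)) (sym (trans (cong (_* f k) (X^-off m k m≢k)) (ℚP.*-zeroˡ (f k)))))

T-ext : ∀ {a b : Bool} → (T a → T b) → (T b → T a) → a ≡ b
T-ext {true}  {true}  _ _ = refl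
T-ext {true}  {false} f _ = ⊥-elim (f tt)
T-ext {false} {true}  _ g = ⊥-elim (g tt)
T-ext {false} {false} _ _ = refl

T-false : ∀ {a : Bool} → ¬ T a → a ≡ false
T-false {true}  ¬a = ⊥-elim (¬a tt)
T-false {false} _  = refl

T-⇒ : ∀ {a b : Bool} → T (not a ∨ b) ⇔ (T a → T b)
T-⇒ {true}  = mk⇔ (λ b _ → b) (λ f → f tt)
T-⇒ {false} = mk⇔ (λ _ ()) (λ _ → tt)

-- Conjunctions and disjunctions over all of Fin n.  Both are folds over
-- tabulate g, which is the form that survives the induction.
all-tabulate : ∀ {n m} (g : Fin n → Fin m) (f : Fin m → Bool) →
  T (foldr (λ v b → f v ∧ b) true (List.tabulate g)) ⇔ (∀ i → T (f (g i)))
all-tabulate {zero}  g f = mk⇔ (λ _ ()) (λ _ → tt)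
all-tabulate {suc n} g f = mk⇔
  (λ h → λ { zero → proj₁ (to T-∧ h) ; (suc i) → to (all-tabulate (g ∘ suc) f) (proj₂ (to T-∧ h)) i })
  (λ h → from T-∧ (h zero , from (all-tabulate (g ∘ suc) f) (h ∘ suc)))

any-tabulate : ∀ {n m} (g : Fin n → Fin m) (f : Fin m → Bool) →
  T (foldr (λ v b → f v ∨ b) false (List.tabulate g)) ⇔ (∃[ i ] T (f (g i)))
any-tabulate {zero}  g f = mk⇔ (λ ()) (λ { (() , _) })
any-tabulate {suc n} g f = mk⇔
  (λ h → [ (λ x → zero , x) , (λ y → Prod.map suc (λ z → z) (to (any-tabulate (g ∘ suc) f) y)) ]′ (to T-∨ h))
  (λ { (zero , x) → from T-∨ (inj₁ x) ; (suc i , x) → from T-∨ (inj₂ (from (any-tabulate (g ∘ suc) f) (i , x))) })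

allB-⇔ : ∀ {n} (f : Fin n → Bool) → T (allB f) ⇔ (∀ i → T (f i))
allB-⇔ = all-tabulate (λ i → i)

anyB-⇔ : ∀ {n} (f : Fin n → Bool) → T (anyB f) ⇔ (∃[ i ] T (f i))
anyB-⇔ = any-tabulate (λ i → i)

_∈ₛ_ : ∀ {n} → Fin n → Subset n → Set
u ∈ₛ S = T (u ∈ᵇ S)

_⊆ₛ_ : ∀ {n} → Subset n → Subset n → Set
W ⊆ₛ S = ∀ u → u ∈ₛ W → u ∈ₛ S

Covered : ∀ {n} → Adj n → Subset n → Fin n → Set
Covered {n} a W u = u ∈ₛ W ⊎ ∃[ w ] (w ∈ₛ W × T (a u w))

Dominating : ∀ {n} → Adj n → Subset n → Subset n → Set
Dominating a S W = ∀ u → u ∈ₛ S → Covered a W u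

⊆ᵇ-⇔ : ∀ {n} (W S : Subset n) → T (W ⊆ᵇ S) ⇔ W ⊆ₛ S
⊆ᵇ-⇔ W S = mk⇔ (λ h u → to T-⇒ (to (allB-⇔ _) h u)) (λ h → from (allB-⇔ _) (λ u → from T-⇒ (h u)))

Dominates-⇔ : ∀ {n} (a : Adj n) (S W : Subset n) → T (Dominates a S W) ⇔ Dominating a S W
Dominates-⇔ a S W = mk⇔
  (λ h u u∈S → covered (to T-∨ (to T-⇒ (to (allB-⇔ _) h u) u∈S)))
  (λ h → from (allB-⇔ _) (λ u → from T-⇒ (λ u∈S → covered⁻¹ (h u u∈S))))
  where
  covered : ∀ {u} → T (u ∈ᵇ W) ⊎ T (anyB (λ w → (w ∈ᵇ W) ∧ a u w)) → Covered a W u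
  covered (inj₁ u∈W) = inj₁ u∈W
  covered (inj₂ h)   = inj₂ (Prod.map (λ w → w) (to T-∧) (to (anyB-⇔ _) h))
  covered⁻¹ : ∀ {u} → Covered a W u → T ((u ∈ᵇ W) ∨ anyB (λ w → (w ∈ᵇ W) ∧ a u w))
  covered⁻¹ (inj₁ u∈W)           = from T-∨ (inj₁ u∈W)
  covered⁻¹ (inj₂ (w , w∈W , uw)) = from T-∨ (inj₂ (from (anyB-⇔ _) (w , from T-∧ (w∈W , uw))))

dominating-set-⇔ : ∀ {n} (a : Adj n) (S W : Subset n) →
  T (W ⊆ᵇ S ∧ Dominates a S W) ⇔ (W ⊆ₛ S × Dominating a S W)
dominating-set-⇔ a S W = mk⇔
  (λ h → Prod.map (to (⊆ᵇ-⇔ W S)) (to (Dominates-⇔ a S W)) (to T-∧ h))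
  (λ h → from T-∧ (Prod.map (from (⊆ᵇ-⇔ W S)) (from (Dominates-⇔ a S W)) h))

covered-mono : ∀ {n} (a a′ : Adj n) (W W′ : Subset n) {u} →
  W ⊆ₛ W′ → (∀ x y → T (a x y) → T (a′ x y)) → Covered a W u → Covered a′ W′ u
covered-mono a a′ W W′ W⊆W′ a⊆a′ (inj₁ u∈W)           = inj₁ (W⊆W′ _ u∈W)
covered-mono a a′ W W′ W⊆W′ a⊆a′ (inj₂ (w , w∈W , uw)) = inj₂ (w , W⊆W′ w w∈W , a⊆a′ _ w uw)

dominating-set-⇔′ : ∀ {n} (a : Adj n) (S W : Subset n) → W ⊆ₛ S →
  T (W ⊆ᵇ S ∧ Dominates a S W) ⇔ Dominating a S W
dominating-set-⇔′ a S W W⊆S = mk⇔ (proj₂ ∘ to (dominating-set-⇔ a S W)) (λ h → from (dominating-set-⇔ a S W) (W⊆S , h))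

∈⊤ : ∀ {n} (u : Fin n) → u ∈ₛ ⊤
∈⊤ u = subst T (sym (VecP.lookup-replicate u true)) tt

∉⊤─⁅v⁆ : ∀ {n} (v : Fin n) → ¬ v ∈ₛ (⊤ ─ ⁅ v ⁆)
∉⊤─⁅v⁆ zero    ()
∉⊤─⁅v⁆ (suc v) = ∉⊤─⁅v⁆ v

∈⊤─⁅v⁆ : ∀ {n} (u v : Fin n) → u ≢ v → u ∈ₛ (⊤ ─ ⁅ v ⁆)
∈⊤─⁅v⁆ zero    zero    u≢v = ⊥-elim (u≢v refl)
∈⊤─⁅v⁆ zero    (suc v) _   = tt
∈⊤─⁅v⁆ (suc u) zero    _   = subst (λ S → u ∈ₛ S) (sym (p─⊥≡p ⊤)) (∈⊤ u)
∈⊤─⁅v⁆ (suc u) (suc v) u≢v = ∈⊤─⁅v⁆ u v (u≢v ∘ cong suc)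

insert : ∀ {n} → Fin n → Subset n → Subset n
insert v W = W [ v ]≔ true

∈insert : ∀ {n} (v : Fin n) (W : Subset n) → v ∈ₛ insert v W
∈insert v W = subst T (sym (VecP.lookup∘update v W true)) tt

∈insert-other : ∀ {n} {u v : Fin n} (W : Subset n) → u ≢ v → u ∈ₛ insert v W → u ∈ₛ W
∈insert-other W u≢v = subst T (VecP.lookup∘update′ u≢v W true)

⊆insert : ∀ {n} (v : Fin n) (W : Subset n) → W ⊆ₛ insert v W
⊆insert v W u u∈W with u ≟ v
... | yes refl = ∈insert v W
... | no u≢v   = subst T (sym (VecP.lookup∘update′ u≢v W true)) u∈W

T-≢ : ∀ {n} (a b : Fin n) → T (not ⌊ a ≟ b ⌋) ⇔ a ≢ b
T-≢ a b with a ≟ b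
... | yes a≡b = mk⇔ (λ ()) (λ a≢b → ⊥-elim (a≢b a≡b))
... | no a≢b  = mk⇔ (λ _ → a≢b) (λ _ → tt)

module _ {n : ℕ} (G : SimpleGraph n) where

  adj-sym : ∀ {u w} → T (adj G u w) → T (adj G w u)
  adj-sym {u} {w} = subst T (SimpleGraph.sym G u w)

  ∈V-N[v] : ∀ {u v} → u ∈ₛ V-N[v] G v ⇔ (u ≢ v × ¬ T (adj G u v))
  ∈V-N[v] {u} {v} rewrite VecP.lookup∘tabulate (λ x → not (⌊ x ≟ v ⌋ ∨ adj G x v)) u with u ≟ v | adj G u v
  ... | yes u≡v | _     = mk⇔ (λ ()) (λ (u≢v , _) → ⊥-elim (u≢v u≡v))
  ... | no u≢v  | true  = mk⇔ (λ ()) (λ (_ , ¬uv) → ⊥-elim (¬uv tt))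
  ... | no u≢v  | false = mk⇔ (λ _ → u≢v , λ ()) (λ _ → tt)

  contractAdj-⇔ : ∀ {v a b} → T (contractAdj G v a b) ⇔ (T (adj G a b) ⊎ ((T (adj G a v) × T (adj G b v)) × a ≢ b))
  contractAdj-⇔ {v} {a} {b} = mk⇔
    (λ h → Sum.map₂ (λ h′ → Prod.map (to T-∧) (to (T-≢ a b)) (to T-∧ h′)) (to T-∨ h))
    (λ h → from T-∨ (Sum.map₂ (λ h′ → from T-∧ (Prod.map (from T-∧) (from (T-≢ a b)) h′)) h))

  isDom : Subset n → Bool
  isDom X = X ⊆ᵇ ⊤ ∧ Dominates (adj G) ⊤ X

  isDom-⇔ : ∀ X → T (isDom X) ⇔ Dominating (adj G) ⊤ X
  isDom-⇔ X = dominating-set-⇔′ (adj G) ⊤ X (λ u _ → ∈⊤ u)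

module LocalIdentity {n : ℕ} (G : SimpleGraph n) (v : Fin n) (W : Subset n) where

  inG-v inG/v inG-N[v] : Bool
  inG-v    = W ⊆ᵇ V-v G v ∧ Dominates (adj G) (V-v G v) W
  inG/v    = W ⊆ᵇ V-v G v ∧ Dominates (contractAdj G v) (V-v G v) W
  inG-N[v] = W ⊆ᵇ V-N[v] G v ∧ Dominates (adj G) (V-N[v] G v) W

  module Inside (v∈W : v ∈ₛ W) where

    inG-v≡false : inG-v ≡ false
    inG-v≡false = T-false λ h → ∉⊤─⁅v⁆ v (proj₁ (to (dominating-set-⇔ (adj G) (V-v G v) W) h) v v∈W)

    inG/v≡false : inG/v ≡ false
    inG/v≡false = T-false λ h → ∉⊤─⁅v⁆ v (proj₁ (to (dominating-set-⇔ (contractAdj G v) (V-v G v) W) h) v v∈W)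

    inG-N[v]≡false : inG-N[v] ≡ false
    inG-N[v]≡false = T-false λ h → proj₁ (to (∈V-N[v] G) (proj₁ (to (dominating-set-⇔ (adj G) (V-N[v] G v) W) h) v v∈W)) refl

    difference≡ : ind inG-v - ind inG/v - ind inG-N[v] ≡ 0ℚ
    difference≡ rewrite inG-v≡false | inG/v≡false | inG-N[v]≡false = refl

  module Outside (v∉W : ¬ v ∈ₛ W) where

    W⊆V-v : W ⊆ₛ V-v G v
    W⊆V-v u u∈W = ∈⊤─⁅v⁆ u v λ { refl → v∉W u∈W }

    G-v-Bool : T inG-v ⇔ Dominating (adj G) (V-v G v) W
    G-v-Bool = dominating-set-⇔′ (adj G) (V-v G v) W W⊆V-v

    G/v-Bool : T inG/v ⇔ Dominating (contractAdj G v) (V-v G v) W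
    G/v-Bool = dominating-set-⇔′ (contractAdj G v) (V-v G v) W W⊆V-v

    -- Some w₀ ∈ W is adjacent to v: then G−N[v] cannot contain W, and
    -- domination of G−v and G/v reduce to domination of G by W and W ∪ {v}.
    module Neighbour (w₀ : Fin n) (w₀∈W : w₀ ∈ₛ W) (v~w₀ : T (adj G v w₀)) where

      G-v-⇔ : Dominating (adj G) (V-v G v) W ⇔ Dominating (adj G) ⊤ W
      G-v-⇔ = mk⇔ forward (λ h u _ → h u (∈⊤ u))
        where
        forward : Dominating (adj G) (V-v G v) W → Dominating (adj G) ⊤ W
        forward h u _ with u ≟ v
        ... | yes refl = inj₂ (w₀ , w₀∈W , v~w₀)
        ... | no u≢v   = h u (∈⊤─⁅v⁆ u v u≢v)

      G/v-⇔ : Dominating (contractAdj G v) (V-v G v) W ⇔ Dominating (adj G) ⊤ (insert v W)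
      G/v-⇔ = mk⇔ forward backward
        where
        -- an edge of G/v is an edge of G or passes through v ∈ W ∪ {v}
        lift : ∀ {u} → Covered (contractAdj G v) W u → Covered (adj G) (insert v W) u
        lift (inj₁ u∈W)          = inj₁ (⊆insert v W _ u∈W)
        lift (inj₂ (w , w∈W , c)) with to (contractAdj-⇔ G) c
        ... | inj₁ u~w              = inj₂ (w , ⊆insert v W w w∈W , u~w)
        ... | inj₂ ((u~v , _) , _)  = inj₂ (v , ∈insert v W , u~v)
        forward : Dominating (contractAdj G v) (V-v G v) W → Dominating (adj G) ⊤ (insert v W)
        forward h u _ with u ≟ v
        ... | yes refl = inj₁ (∈insert v W)
        ... | no u≢v   = lift (h u (∈⊤─⁅v⁆ u v u≢v))
        -- a neighbour u of v is joined in G/v to w₀ unless u = w₀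
        lower : ∀ {u} → u ≢ v → Covered (adj G) (insert v W) u → Covered (contractAdj G v) W u
        lower u≢v (inj₁ u∈W+v) = inj₁ (∈insert-other W u≢v u∈W+v)
        lower {u} u≢v (inj₂ (w , w∈W+v , u~w)) with w ≟ v | u ≟ w₀
        ... | no w≢v   | _        = inj₂ (w , ∈insert-other W w≢v w∈W+v , from (contractAdj-⇔ G) (inj₁ u~w))
        ... | yes refl | yes refl = inj₁ w₀∈W
        ... | yes refl | no u≢w₀  = inj₂ (w₀ , w₀∈W , from (contractAdj-⇔ G) (inj₂ ((u~w , adj-sym G v~w₀) , u≢w₀)))
        backward : Dominating (adj G) ⊤ (insert v W) → Dominating (contractAdj G v) (V-v G v) W
        backward h u u∈V-v = lower (λ { refl → ∉⊤─⁅v⁆ v u∈V-v }) (h u (∈⊤ u))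

      ¬W⊆V-N[v] : ¬ W ⊆ₛ V-N[v] G v
      ¬W⊆V-N[v] W⊆ = proj₂ (to (∈V-N[v] G) (W⊆ w₀ w₀∈W)) (adj-sym G v~w₀)

      inG-v≡ : inG-v ≡ isDom G W
      inG-v≡ = T-ext (from (isDom-⇔ G W) ∘ to G-v-⇔ ∘ to G-v-Bool)
                     (from G-v-Bool ∘ from G-v-⇔ ∘ to (isDom-⇔ G W))

      inG/v≡ : inG/v ≡ isDom G (insert v W)
      inG/v≡ = T-ext (from (isDom-⇔ G (insert v W)) ∘ to G/v-⇔ ∘ to G/v-Bool)
                     (from G/v-Bool ∘ from G/v-⇔ ∘ to (isDom-⇔ G (insert v W)))

      inG-N[v]≡false : inG-N[v] ≡ false
      inG-N[v]≡false = T-false (¬W⊆V-N[v] ∘ proj₁ ∘ to (dominating-set-⇔ (adj G) (V-N[v] G v) W))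

      difference≡ : ind inG-v - ind inG/v - ind inG-N[v] ≡ ind (isDom G W) - ind (isDom G (insert v W))
      difference≡ rewrite inG-v≡ | inG/v≡ | inG-N[v]≡false =
        solve 2 (λ x y → x :- y :- con 0ℚ := x :- y) refl (ind (isDom G W)) (ind (isDom G (insert v W)))

    -- No neighbour of v lies in W: then W does not dominate G, the new
    -- edges of G/v are irrelevant, and W dominates G−N[v] exactly when
    -- W ∪ {v} dominates G.
    module NoNeighbour (no-nb : ∀ w → w ∈ₛ W → ¬ T (adj G v w)) where

      ¬dominates-G : ¬ Dominating (adj G) ⊤ W
      ¬dominates-G h with h v (∈⊤ v)
      ... | inj₁ v∈W              = v∉W v∈W
      ... | inj₂ (w , w∈W , v~w) = no-nb w w∈W v~w

      G/v-⇔ : Dominating (contractAdj G v) (V-v G v) W ⇔ Dominating (adj G) (V-v G v) W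
      G/v-⇔ = mk⇔ (λ h u u∈ → drop (h u u∈))
                  (λ h u u∈ → covered-mono (adj G) (contractAdj G v) W W (λ _ x → x) (λ _ _ → from (contractAdj-⇔ G) ∘ inj₁) (h u u∈))
        where
        drop : ∀ {u} → Covered (contractAdj G v) W u → Covered (adj G) W u
        drop (inj₁ u∈W) = inj₁ u∈W
        drop (inj₂ (w , w∈W , c)) with to (contractAdj-⇔ G) c
        ... | inj₁ u~w             = inj₂ (w , w∈W , u~w)
        ... | inj₂ ((_ , w~v) , _) = ⊥-elim (no-nb w w∈W (adj-sym G w~v))

      G-N[v]-⇔ : (W ⊆ₛ V-N[v] G v × Dominating (adj G) (V-N[v] G v) W) ⇔ Dominating (adj G) ⊤ (insert v W)
      G-N[v]-⇔ = mk⇔ forward backward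
        where
        forward : W ⊆ₛ V-N[v] G v × Dominating (adj G) (V-N[v] G v) W → Dominating (adj G) ⊤ (insert v W)
        forward (_ , h) u _ with u ≟ v | T? (adj G u v)
        ... | yes refl | _        = inj₁ (∈insert v W)
        ... | no _     | yes u~v  = inj₂ (v , ∈insert v W , u~v)
        ... | no u≢v   | no ¬u~v  = covered-mono (adj G) (adj G) W (insert v W) (⊆insert v W) (λ _ _ x → x) (h u (from (∈V-N[v] G) (u≢v , ¬u~v)))
        lower : ∀ {u} → u ≢ v → ¬ T (adj G u v) → Covered (adj G) (insert v W) u → Covered (adj G) W u
        lower u≢v ¬u~v (inj₁ u∈W+v) = inj₁ (∈insert-other W u≢v u∈W+v)
        lower u≢v ¬u~v (inj₂ (w , w∈W+v , u~w)) with w ≟ v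
        ... | yes refl = ⊥-elim (¬u~v u~w)
        ... | no w≢v   = inj₂ (w , ∈insert-other W w≢v w∈W+v , u~w)
        backward : Dominating (adj G) ⊤ (insert v W) → W ⊆ₛ V-N[v] G v × Dominating (adj G) (V-N[v] G v) W
        backward h = (λ w w∈W → from (∈V-N[v] G) ((λ { refl → v∉W w∈W }) , no-nb w w∈W ∘ adj-sym G))
                   , (λ u u∈ → let (u≢v , ¬u~v) = to (∈V-N[v] G) u∈ in lower u≢v ¬u~v (h u (∈⊤ u)))

      isDom≡false : isDom G W ≡ false
      isDom≡false = T-false (¬dominates-G ∘ to (isDom-⇔ G W))

      inG/v≡ : inG/v ≡ inG-v
      inG/v≡ = T-ext (from G-v-Bool ∘ to G/v-⇔ ∘ to G/v-Bool)
                     (from G/v-Bool ∘ from G/v-⇔ ∘ to G-v-Bool)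

      inG-N[v]≡ : inG-N[v] ≡ isDom G (insert v W)
      inG-N[v]≡ = T-ext (from (isDom-⇔ G (insert v W)) ∘ to G-N[v]-⇔ ∘ to (dominating-set-⇔ (adj G) (V-N[v] G v) W))
                        (from (dominating-set-⇔ (adj G) (V-N[v] G v) W) ∘ from G-N[v]-⇔ ∘ to (isDom-⇔ G (insert v W)))

      difference≡ : ind inG-v - ind inG/v - ind inG-N[v] ≡ ind (isDom G W) - ind (isDom G (insert v W))
      difference≡ rewrite inG/v≡ | inG-N[v]≡ | isDom≡false =
        solve 2 (λ x y → x :- x :- y := con 0ℚ :- y) refl (ind inG-v) (ind (isDom G (insert v W)))

  local-identity : ind inG-v - ind inG/v - ind inG-N[v] ≡ ind (not (v ∈ᵇ W)) * (ind (isDom G W) - ind (isDom G (insert v W)))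
  local-identity with v ∈ᵇ W in v∈ᵇW
  ... | true  = trans (Inside.difference≡ (subst T (sym v∈ᵇW) tt)) (sym (ℚP.*-zeroˡ (ind (isDom G W) - ind (isDom G (insert v W)))))
  ... | false with any? (λ w → T? (w ∈ᵇ W) ×-dec T? (adj G v w))
  ...   | yes (w₀ , w₀∈W , v~w₀) =
    trans (Outside.Neighbour.difference≡ (λ v∈W → subst T v∈ᵇW v∈W) w₀ w₀∈W v~w₀) (sym (ℚP.*-identityˡ (ind (isDom G W) - ind (isDom G (insert v W)))))
  ...   | no ∄w =
    trans (Outside.NoNeighbour.difference≡ (λ v∈W → subst T v∈ᵇW v∈W) (λ w w∈W v~w → ∄w (w , w∈W , v~w))) (sym (ℚP.*-identityˡ (ind (isDom G W) - ind (isDom G (insert v W)))))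

card-insert : ∀ {n} (v : Fin n) (W : Subset n) → v ∈ᵇ W ≡ false → ∣ insert v W ∣ ≡ suc ∣ W ∣
card-insert zero    (false ∷ W) _    = refl
card-insert (suc v) (false ∷ W) v∉W = card-insert v W v∉W
card-insert (suc v) (true ∷ W)  v∉W = cong suc (card-insert v W v∉W)

-- W ↦ W ∪ {v} is a bijection from the sets avoiding v to the sets containing v.
sum-insert : ∀ n (v : Fin n) (f : Subset n → ℚ) →
  sumS n (λ W → ind (not (v ∈ᵇ W)) * f (insert v W)) ≡ sumS n (λ W → ind (v ∈ᵇ W) * f W)
sum-insert (suc n) zero f = begin
  sumS (suc n) (λ W → ind (not (zero ∈ᵇ W)) * f (insert zero W))
    ≡⟨ sumS-suc n (λ W → ind (not (zero ∈ᵇ W)) * f (insert zero W)) ⟩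
  sumS n (λ W → 1ℚ * f (true ∷ W)) + sumS n (λ W → 0ℚ * f (true ∷ W))
    ≡⟨ ℚP.+-comm (sumS n (λ W → 1ℚ * f (true ∷ W))) (sumS n (λ W → 0ℚ * f (true ∷ W))) ⟩
  sumS n (λ W → 0ℚ * f (true ∷ W)) + sumS n (λ W → 1ℚ * f (true ∷ W))
    ≡⟨ cong (_+ sumS n (λ W → 1ℚ * f (true ∷ W))) (trans (sumL-zero (allSubsets n) (λ W → ℚP.*-zeroˡ (f (true ∷ W))))
                          (sym (sumL-zero (allSubsets n) (λ W → ℚP.*-zeroˡ (f (false ∷ W)))))) ⟩
  sumS n (λ W → 0ℚ * f (false ∷ W)) + sumS n (λ W → 1ℚ * f (true ∷ W))
    ≡⟨ sym (sumS-suc n (λ W → ind (zero ∈ᵇ W) * f W)) ⟩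
  sumS (suc n) (λ W → ind (zero ∈ᵇ W) * f W) ∎
sum-insert (suc n) (suc v) f = begin
  sumS (suc n) (λ W → ind (not (suc v ∈ᵇ W)) * f (insert (suc v) W))
    ≡⟨ sumS-suc n (λ W → ind (not (suc v ∈ᵇ W)) * f (insert (suc v) W)) ⟩
  sumS n (λ W → ind (not (v ∈ᵇ W)) * f (false ∷ insert v W)) + sumS n (λ W → ind (not (v ∈ᵇ W)) * f (true ∷ insert v W))
    ≡⟨ cong₂ _+_ (sum-insert n v (λ W → f (false ∷ W))) (sum-insert n v (λ W → f (true ∷ W))) ⟩
  sumS n (λ W → ind (v ∈ᵇ W) * f (false ∷ W)) + sumS n (λ W → ind (v ∈ᵇ W) * f (true ∷ W))
    ≡⟨ sym (sumS-suc n (λ W → ind (suc v ∈ᵇ W) * f W)) ⟩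
  sumS (suc n) (λ W → ind (suc v ∈ᵇ W) * f W) ∎

count-members : ∀ n (W : Subset n) → sumV n (λ v → ind (v ∈ᵇ W)) ≡ ι ∣ W ∣
count-members zero    []          = refl
count-members (suc n) (false ∷ W) = trans (sumV-suc n (λ v → ind (v ∈ᵇ (false ∷ W)))) (trans (ℚP.+-identityˡ _) (count-members n W))
count-members (suc n) (true ∷ W)  = trans (sumV-suc n (λ v → ind (v ∈ᵇ (true ∷ W)))) (trans (cong (_+_ 1ℚ) (count-members n W)) (sym (ι-+ 1 ∣ W ∣)))

count-non-members : ∀ n (W : Subset n) → sumV n (λ v → ind (not (v ∈ᵇ W))) ≡ ι n - ι ∣ W ∣
count-non-members n W = begin
  sumV n (λ v → ind (not (v ∈ᵇ W)))         ≡⟨ sumL-cong (allFin n) (λ v → ind-not (v ∈ᵇ W)) ⟩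
  sumV n (λ v → 1ℚ - ind (v ∈ᵇ W))          ≡⟨ sumL-- (allFin n) (λ _ → 1ℚ) (λ v → ind (v ∈ᵇ W)) ⟩
  sumV n (λ _ → 1ℚ) - sumV n (λ v → ind (v ∈ᵇ W)) ≡⟨ cong₂ _-_ (count-all n) (count-members n W) ⟩
  ι n - ι ∣ W ∣                             ∎
  where
  ind-not : ∀ b → ind (not b) ≡ 1ℚ - ind b
  ind-not true  = refl
  ind-not false = refl
  count-all : ∀ n → sumV n (λ _ → 1ℚ) ≡ ι n
  count-all zero    = refl
  count-all (suc n) = trans (sumV-suc n (λ _ → 1ℚ)) (trans (cong (_+_ 1ℚ) (count-all n)) (sym (ι-+ 1 n)))

count-members-* : ∀ n (W : Subset n) c → sumV n (λ v → ind (v ∈ᵇ W) * c) ≡ ι ∣ W ∣ * c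
count-members-* n W c = trans (sumL-*ʳ (allFin n) c (λ v → ind (v ∈ᵇ W))) (cong (_* c) (count-members n W))

count-non-members-* : ∀ n (W : Subset n) c → sumV n (λ v → ind (not (v ∈ᵇ W)) * c) ≡ (ι n - ι ∣ W ∣) * c
count-non-members-* n W c = trans (sumL-*ʳ (allFin n) c (λ v → ind (not (v ∈ᵇ W)))) (cong (_* c) (count-non-members n W))

ΣL-coeff : ∀ (xs : List X) (f : X → Poly) k → ΣL xs f k ≡ sumL xs (λ x → f x k)
ΣL-coeff []       f k = refl
ΣL-coeff (x ∷ xs) f k = cong (_+_ (f x k)) (ΣL-coeff xs f k)

weight-by-size : ∀ (g : ℕ → ℚ) s k c → g s * (c * X^ s k) ≡ g k * (c * X^ s k)
weight-by-size g s k c = begin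
  g s * (c * X^ s k)  ≡⟨ solve 3 (λ a b x → a :* (b :* x) := b :* (x :* a)) refl (g s) c (X^ s k) ⟩
  c * (X^ s k * g s)  ≡⟨ cong (c *_) (X^-select s k g) ⟩
  c * (X^ s k * g k)  ≡⟨ solve 3 (λ a b x → b :* (x :* a) := a :* (b :* x)) refl (g k) c (X^ s k) ⟩
  g k * (c * X^ s k)  ∎

module _ {n : ℕ} (G : SimpleGraph n) where

  open LocalIdentity G using (inG-v; inG/v; inG-N[v]; local-identity)

  dominatingOfSize : ℕ → Subset n → ℚ
  dominatingOfSize k W = ind (isDom G W) * X^ ∣ W ∣ k

  D-coeff : ∀ k → D G k ≡ sumS n (dominatingOfSize k)
  D-coeff = Dom-coeff (adj G) ⊤

  -- The local identity weighted by x^|W|; on the right, W ∪ {v} is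
  -- weighted by its own size |W| + 1.
  weighted-local-identity : ∀ v k W →
    (ind (inG-v v W) * X^ (∣ W ∣) k - ind (inG/v v W) * X^ (∣ W ∣) k) - ind (inG-N[v] v W) * X^ (∣ W ∣) k ≡
    ind (not (v ∈ᵇ W)) * dominatingOfSize k W - ind (not (v ∈ᵇ W)) * dominatingOfSize (suc k) (insert v W)
  weighted-local-identity v k W = begin
    (ind (inG-v v W) * xᵏ - ind (inG/v v W) * xᵏ) - ind (inG-N[v] v W) * xᵏ
      ≡⟨ solve 4 (λ a b c x → (a :* x :- b :* x) :- c :* x := (a :- b :- c) :* x) refl (ind (inG-v v W)) (ind (inG/v v W)) (ind (inG-N[v] v W)) xᵏ ⟩
    (ind (inG-v v W) - ind (inG/v v W) - ind (inG-N[v] v W)) * xᵏ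
      ≡⟨ cong (_* xᵏ) (local-identity v W) ⟩
    (v∉W * (ind (isDom G W) - ind (isDom G (insert v W)))) * xᵏ
      ≡⟨ solve 4 (λ o d e x → (o :* (d :- e)) :* x := o :* (d :* x) :- o :* (e :* x)) refl v∉W (ind (isDom G W)) (ind (isDom G (insert v W))) xᵏ ⟩
    v∉W * dominatingOfSize k W - v∉W * (ind (isDom G (insert v W)) * xᵏ)
      ≡⟨ cong (_-_ (v∉W * dominatingOfSize k W)) (shift-size (ind (isDom G (insert v W)))) ⟩
    v∉W * dominatingOfSize k W - v∉W * dominatingOfSize (suc k) (insert v W) ∎
    where
    xᵏ v∉W : ℚ
    xᵏ  = X^ ∣ W ∣ k
    v∉W = ind (not (v ∈ᵇ W))
    shift-size : ∀ c → ind (not (v ∈ᵇ W)) * (c * xᵏ) ≡ ind (not (v ∈ᵇ W)) * (c * X^ ∣ insert v W ∣ (suc k))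
    shift-size c with v ∈ᵇ W in v∈ᵇW
    ... | true  = trans (ℚP.*-zeroˡ (c * xᵏ)) (sym (ℚP.*-zeroˡ (c * X^ ∣ insert v W ∣ (suc k))))
    ... | false rewrite card-insert v W v∈ᵇW | X^-suc ∣ W ∣ k = refl

  vertex-term : ∀ v k → ((D[G-v] G v ⊖ D[G/v] G v) ⊖ D[G-N[v]] G v) k ≡
    sumS n (λ W → ind (not (v ∈ᵇ W)) * dominatingOfSize k W) - sumS n (λ W → ind (v ∈ᵇ W) * dominatingOfSize (suc k) W)
  vertex-term v k = begin
    (D[G-v] G v k - D[G/v] G v k) - D[G-N[v]] G v k
      ≡⟨ cong₂ _-_ (cong₂ _-_ (Dom-coeff (adj G) (V-v G v) k) (Dom-coeff (contractAdj G v) (V-v G v) k)) (Dom-coeff (adj G) (V-N[v] G v) k) ⟩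
    (sumS n p - sumS n q) - sumS n r
      ≡⟨ sym (trans (sumL-- (allSubsets n) (λ W → p W - q W) r) (cong (_- sumS n r) (sumL-- (allSubsets n) p q))) ⟩
    sumS n (λ W → (p W - q W) - r W)
      ≡⟨ sumL-cong (allSubsets n) (weighted-local-identity v k) ⟩
    sumS n (λ W → avoid W - avoid+ W)
      ≡⟨ sumL-- (allSubsets n) avoid avoid+ ⟩
    sumS n avoid - sumS n avoid+
      ≡⟨ cong (_-_ (sumS n avoid)) (sum-insert n v (dominatingOfSize (suc k))) ⟩
    sumS n avoid - sumS n (λ W → ind (v ∈ᵇ W) * dominatingOfSize (suc k) W) ∎
    where
    p q r avoid avoid+ : Subset n → ℚ
    p W = ind (inG-v v W) * X^ ∣ W ∣ k
    q W = ind (inG/v v W) * X^ ∣ W ∣ k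
    r W = ind (inG-N[v] v W) * X^ ∣ W ∣ k
    avoid W  = ind (not (v ∈ᵇ W)) * dominatingOfSize k W
    avoid+ W = ind (not (v ∈ᵇ W)) * dominatingOfSize (suc k) (insert v W)

  -- Summing the vertex terms: a dominating set W of size k is counted once
  -- for each of the n−k vertices outside it, one of size k+1 once for each
  -- of its k+1 elements.
  A-identity : A G ≈ₚ ((ι n · D G) ⊖ mul1+x (deriv (D G)))
  A-identity k = begin
    A G k
      ≡⟨ ΣL-coeff (allFin n) (λ v → (D[G-v] G v ⊖ D[G/v] G v) ⊖ D[G-N[v]] G v) k ⟩
    sumV n (λ v → ((D[G-v] G v ⊖ D[G/v] G v) ⊖ D[G-N[v]] G v) k)
      ≡⟨ sumL-cong (allFin n) (λ v → vertex-term v k) ⟩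
    sumV n (λ v → sumS n (avoiding v) - sumS n (containing v))
      ≡⟨ sumL-- (allFin n) (λ v → sumS n (avoiding v)) (λ v → sumS n (containing v)) ⟩
    sumV n (λ v → sumS n (avoiding v)) - sumV n (λ v → sumS n (containing v))
      ≡⟨ cong₂ _-_ (sumL-swap (allFin n) (allSubsets n) avoiding) (sumL-swap (allFin n) (allSubsets n) containing) ⟩
    sumS n (λ W → sumV n (λ v → avoiding v W)) - sumS n (λ W → sumV n (λ v → containing v W))
      ≡⟨ cong₂ _-_ (sumL-cong (allSubsets n) count-avoiding) (sumL-cong (allSubsets n) count-containing) ⟩
    sumS n (λ W → (ι n - ι k) * dominatingOfSize k W) - sumS n (λ W → ι (suc k) * dominatingOfSize (suc k) W)
      ≡⟨ cong₂ _-_ (trans (sumL-* (allSubsets n) (ι n - ι k) (dominatingOfSize k)) (cong ((ι n - ι k) *_) (sym (D-coeff k))))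
                   (trans (sumL-* (allSubsets n) (ι (suc k)) (dominatingOfSize (suc k))) (cong (ι (suc k) *_) (sym (D-coeff (suc k))))) ⟩
    (ι n - ι k) * D G k - ι (suc k) * D G (suc k)
      ≡⟨ sym (nD-mul1+xD′-coeff n (D G) k) ⟩
    ι n * D G k - mul1+x (deriv (D G)) k ∎
    where
    avoiding containing : Fin n → Subset n → ℚ
    avoiding v W   = ind (not (v ∈ᵇ W)) * dominatingOfSize k W
    containing v W = ind (v ∈ᵇ W) * dominatingOfSize (suc k) W
    count-avoiding : ∀ W → sumV n (λ v → avoiding v W) ≡ (ι n - ι k) * dominatingOfSize k W
    count-avoiding W = trans (count-non-members-* n W (dominatingOfSize k W))
                             (weight-by-size (λ s → ι n - ι s) ∣ W ∣ k (ind (isDom G W)))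
    count-containing : ∀ W → sumV n (λ v → containing v W) ≡ ι (suc k) * dominatingOfSize (suc k) W
    count-containing W = trans (count-members-* n W (dominatingOfSize (suc k) W))
                               (weight-by-size ι ∣ W ∣ (suc k) (ind (isDom G W)))

  -- D(G,x) is monic of degree n: only W = V has size n, and no set is larger.
  D-leading : D G n ≡ 1ℚ
  D-leading = trans (D-coeff n) (trans (only-full-set n (λ W → ind (isDom G W))) (cong ind V-dominates))
    where
    only-full-set : ∀ m (g : Subset m → ℚ) → sumS m (λ W → g W * X^ ∣ W ∣ m) ≡ g ⊤
    only-full-set zero    g = trans (ℚP.+-identityʳ _) (ℚP.*-identityʳ (g []))
    only-full-set (suc m) g = begin
      sumS (suc m) (λ W → g W * X^ ∣ W ∣ (suc m))
        ≡⟨ sumS-suc m (λ W → g W * X^ ∣ W ∣ (suc m)) ⟩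
      sumS m (λ W → g (false ∷ W) * X^ ∣ W ∣ (suc m)) + sumS m (λ W → g (true ∷ W) * X^ (suc ∣ W ∣) (suc m))
        ≡⟨ cong₂ _+_ (sumL-zero (allSubsets m) (λ W → trans (cong (g (false ∷ W) *_) (X^-off ∣ W ∣ (suc m) (too-small W))) (ℚP.*-zeroʳ (g (false ∷ W)))))
                     (trans (sumL-cong (allSubsets m) (λ W → cong (g (true ∷ W) *_) (X^-suc ∣ W ∣ m))) (only-full-set m (λ W → g (true ∷ W)))) ⟩
      0ℚ + g ⊤
        ≡⟨ ℚP.+-identityˡ (g ⊤) ⟩
      g ⊤ ∎
      where
      too-small : ∀ W → ∣ W ∣ ≢ suc m
      too-small W eq = ℕP.<-irrefl eq (s≤s (∣p∣≤n W))
    V-dominates : isDom G ⊤ ≡ true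
    V-dominates = T-ext (λ _ → tt) (λ _ → from (isDom-⇔ G ⊤) (λ u _ → inj₁ (∈⊤ u)))

  D-above : ∀ k → D G (n ℕ.+ suc k) ≡ 0ℚ
  D-above k = trans (D-coeff (n ℕ.+ suc k)) (sumL-zero (allSubsets n) (λ W →
    trans (cong (ind (isDom G W) *_) (X^-off ∣ W ∣ (n ℕ.+ suc k) (λ eq → ℕP.m+1+n≰m n (subst (_≤ n) eq (∣p∣≤n W)))))
          (ℚP.*-zeroʳ (ind (isDom G W)))))

mainTheorem13 : (n : ℕ) (G : SimpleGraph n) →
    D G ≈ₚ ((1+x ^ₚ n) ⊕ Σₚ n (λ i → (1+x ^ₚ i) ⊗ (factCoef n i · deriv^ i (A G))))
mainTheorem13 n G = Expansion.expansion n (D G) (A G) (A-identity G) (D-leading G) (D-above G)
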